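{- Let $k\ge1$ be a natural number and ${\cal J}=O^{3}_1\odot O^{5}_2\odot\cdots\odot O^{2k+1}_k$ (representing the $\le_L$-join of the $G_{O^{2m+1}_m}$, $1\le m\le k$). Then $G_{\cal J}\le_L G_{\{\{0\},\{1\}\}}$ and $G_{\{\{0\},\{1\}\}}\not\le_L G_{\cal J}$, i.e. this join is strictly below $\neg\neg$.
   Context: Notation: $ex$ is the (possibly undefined) result of applying the $e$-th partial recursive function to $x$; $\langle\cdot,\cdot\rangle$ a recursive pairing. For $A,C\subseteq\mathbb N$: $A\wedge C=\{\langle a,c\rangle\mid a\in A,c\in C\}$, $A\to C=\{e\mid\forall a\in A\ (ea\text{ defined and in }C)\}$. For a nonempty family ${\cal A}$ of subsets of $\mathbb N$, $G_{\cal A}(p)=\bigcup_{A\in{\cal A}}(A\to p)$; ${\cal A}\odot{\cal B}=\{A\wedge B\mid A\in{\cal A},B\in{\cal B}\}$. For $f,g$: $f\le g$ means $\bigcap_p(f(p)\to g(p))\ne\emptyset$; $L(g)(p)=\bigcap_{q}\big(((p\to q)\wedge(g(q)\to q))\to q\big)$; $f\le_L g$ means $f\le L(g)$. $L(G_{\{\{0\},\{1\}\}})$ represents the double-negation local operator. For $n\in\mathbb N$, identify $n$ with $\{1,\ldots,n\}$; $O^n_m=\{X\subseteq n\mid |n\setminus X|=m\}$. -}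

module Defs where

open import Level using (Level; _⊔_) renaming (zero to lzero; suc to lsuc)
open import Data.Nat using (ℕ; zero; suc; _+_; _*_; _%_; _/_)
open import Data.Product using (Σ; _×_; _,_; proj₁; proj₂)
open import Data.Maybe using (Maybe; just; nothing; _>>=_)
open import Data.Fin using (Fin; toℕ)
open import Data.Fin.Subset using (Subset; ∁; ∣_∣; _∈_)
open import Relation.Binary.PropositionalEquality using (_≡_)

tri : ℕ → ℕ
tri zero    = zero
tri (suc n) = suc n + tri n

⟨_,_⟩ : ℕ → ℕ → ℕ
⟨ a , b ⟩ = tri (a + b) + b

-- unpair n = the pair (a , b) with ⟨ a , b ⟩ ≡ n (Cantor enumeration order)
unpair : ℕ → ℕ × ℕ
unpair zero = 0 , 0
unpair (suc n) with unpair n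
... | zero  , b = suc b , 0
... | suc a , b = a , suc b

-- A Turing-complete programming language for unary partial functions
-- on ℕ (μ-recursive functions, with arguments packed by pairing).

data Code : Set where
  Z S Id Fst Snd : Code
  Comp Pair Rec  : Code → Code → Code
  Mu             : Code → Code

-- Fuel-bounded evaluation: 'nothing' means "out of fuel / undefined".
mutual
  eval : ℕ → Code → ℕ → Maybe ℕ
  eval zero    _          _ = nothing
  eval (suc n) Z          x = just 0
  eval (suc n) S          x = just (suc x)
  eval (suc n) Id         x = just x
  eval (suc n) Fst        x = just (proj₁ (unpair x))
  eval (suc n) Snd        x = just (proj₂ (unpair x))
  eval (suc n) (Comp f g) x = eval n g x >>= eval n f
  eval (suc n) (Pair f g) x = eval n f x >>= λ a → eval n g x >>= λ b → just ⟨ a , b ⟩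
  eval (suc n) (Rec f g)  x = evalRec n f g (proj₁ (unpair x)) (proj₂ (unpair x))
  eval (suc n) (Mu f)     x = evalMu n f x 0

  evalRec : ℕ → Code → Code → ℕ → ℕ → Maybe ℕ
  evalRec zero    f g a _       = nothing
  evalRec (suc n) f g a zero    = eval n f a
  evalRec (suc n) f g a (suc m) =
    evalRec n f g a m >>= λ r → eval n g ⟨ ⟨ a , m ⟩ , r ⟩

  evalMu : ℕ → Code → ℕ → ℕ → Maybe ℕ
  evalMu zero    f x i = nothing
  evalMu (suc n) f x i = eval n f ⟨ x , i ⟩ >>= step
    where
    step : ℕ → Maybe ℕ
    step zero    = just i
    step (suc _) = evalMu n f x (suc i)

-- A surjective (indeed effective) numbering ℕ → Code.
decodeF : ℕ → ℕ → Code
decodeF zero    _ = Z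
decodeF (suc f) n = pick (n % 9) (n / 9)
  where
  pick : ℕ → ℕ → Code
  pick 0 _ = Z
  pick 1 _ = S
  pick 2 _ = Id
  pick 3 _ = Fst
  pick 4 _ = Snd
  pick 5 r = Comp (decodeF f (proj₁ (unpair r))) (decodeF f (proj₂ (unpair r)))
  pick 6 r = Pair (decodeF f (proj₁ (unpair r))) (decodeF f (proj₂ (unpair r)))
  pick 7 r = Rec  (decodeF f (proj₁ (unpair r))) (decodeF f (proj₂ (unpair r)))
  pick _ r = Mu   (decodeF f r)

decode : ℕ → Code
decode n = decodeF (suc n) n

_·_↓_ : ℕ → ℕ → ℕ → Set
e · x ↓ y = Σ ℕ λ fuel → eval fuel (decode e) x ≡ just y

Pred : (ℓ : Level) → Set (lsuc ℓ)
Pred ℓ = ℕ → Set ℓ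

_∧_ : {a c : Level} → Pred a → Pred c → Pred (a ⊔ c)
(A ∧ C) x = Σ ℕ λ a → Σ ℕ λ c → A a × C c × x ≡ ⟨ a , c ⟩

_⇒_ : {a c : Level} → Pred a → Pred c → Pred (a ⊔ c)
(A ⇒ C) e = ∀ a → A a → Σ ℕ λ y → (e · a ↓ y) × C y

-- (All families used below are nonempty.)
record Family : Set₁ where
  field
    Ix  : Set
    set : Ix → Pred lzero
open Family public

G : Family → Pred lzero → Pred lzero
G 𝒜 p e = Σ (Ix 𝒜) λ i → (set 𝒜 i ⇒ p) e

_⊙_ : Family → Family → Family
Ix  (𝒜 ⊙ ℬ) = Ix 𝒜 × Ix ℬ
set (𝒜 ⊙ ℬ) (i , j) = set 𝒜 i ∧ set ℬ j

data Two : Set where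
  t0 t1 : Two

Fam01 : Family
Ix Fam01 = Two
set Fam01 t0 x = x ≡ 0
set Fam01 t1 x = x ≡ 1

-- n is identified with {1,…,n}; a subset X ⊆ {1,…,n} is a Subset n
-- (position i : Fin n stands for the number toℕ i + 1).
asSet : {n : ℕ} → Subset n → Pred lzero
asSet {n} X a = Σ (Fin n) λ i → (suc (toℕ i) ≡ a) × (i ∈ X)

record OIx (n m : ℕ) : Set where
  constructor oix
  field
    sub : Subset n
    card : ∣ ∁ sub ∣ ≡ m

O : (n m : ℕ) → Family
Ix  (O n m) = OIx n m
set (O n m) i = asSet (OIx.sub i)

-- 𝒥_k = O^3_1 ⊙ O^5_2 ⊙ ⋯ ⊙ O^{2k+1}_k  (left-nested), for k ≥ 1.
-- The value at k = 0 is an unused placeholder.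
𝒥 : ℕ → Family
𝒥 zero = O 1 0
𝒥 (suc zero) = O 3 1
𝒥 (suc (suc k)) = 𝒥 (suc k) ⊙ O (2 * (suc (suc k)) + 1) (suc (suc k))

_≤R_ : {ℓ : Level} → (Pred lzero → Pred lzero) → (Pred lzero → Pred ℓ) → Set (lsuc lzero ⊔ ℓ)
f ≤R g = Σ ℕ λ e → ∀ p → (f p ⇒ g p) e

L : (Pred lzero → Pred lzero) → Pred lzero → Pred (lsuc lzero)
L g p x = ∀ (q : Pred lzero) → (((p ⇒ q) ∧ (g q ⇒ q)) ⇒ q) x

_≤L_ : (Pred lzero → Pred lzero) → (Pred lzero → Pred lzero) → Set₁
f ≤L g = f ≤R L g

-- Write ¬¬ for G_{{0},{1}}.  Any two members of 𝒥 meet: two subsets of a (2m+1)-set, each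
-- missing only m points, share a point.  Both directions use nothing else about 𝒥.
--
-- G_𝒜 ≤_L ¬¬ for every family of nonempty sets: given f ∈ A → p, a ∈ p → q and c ∈ ¬¬(q) → q,
-- build uniformly in (a, c, f) codes z_0, z_1, … with z_s 0 = a (f s) and z_s 1 = c z_{s+1}.
-- For any t ∈ A, z_t ∈ {0} → q, and then z_s ∈ {1} → q for s < t by downward induction; so
-- c z_0 ∈ q, and the realizer does not need to know t.
--
-- ¬¬ ≰_L G_𝒜 for every intersecting family: the identity lies in ¬¬({0}) and ¬¬({1}), so a
-- reduction yields one code r in L(G_𝒜)({0}) ∩ L(G_𝒜)({1}).  Feeding r the pair
-- (x ↦ ⟨0,x⟩, z ↦ ⟨1,z⟩) lands in both T_0 and T_1, where the tower T_b is the least set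
-- containing ⟨0,b⟩ and ⟨1,z⟩ for z ∈ G_𝒜(T_b); but T_0 ∩ T_1 = ∅, because two members of 𝒜
-- share an argument and application is deterministic.
--
-- Since the realizers apply codes given as data, they are built from a universal code for the
-- Code language (an abstract machine with a primitive recursive step function) and s-m-n.

module Submission where

open import Defs renaming (⟨_,_⟩ to ⟨_,_⟩ᴰ)
open import Level using () renaming (zero to lzero)
open import Data.Bool using (true; false; not)
open import Data.Empty using (⊥; ⊥-elim)
import Data.Fin as Fin
open Fin using (Fin; toℕ)
open import Data.Fin.Subset using (Subset; ∁; ∣_∣; _∈_)
open import Data.Fin.Subset.Properties using (∣p∣≤∣x∷p∣)
open import Data.List using (List; []; _∷_)
open import Data.Maybe using (Maybe; just; _>>=_)
open import Data.Maybe.Properties using (just-injective)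
open import Data.Nat
open import Data.Nat.DivMod
open import Data.Nat.Divisibility using (n∣m*n)
open import Data.Nat.Properties
open import Data.Product using (Σ; _×_; _,_; proj₁; proj₂)
open import Data.Sum using (_⊎_; inj₁; inj₂)
open import Data.Vec using ([]; _∷_; here; there)
open import Function using (_∘_)
open import Relation.Binary.PropositionalEquality
open import Relation.Nullary using (¬_)
open import Relation.Nullary.Decidable using (True; toWitness)

unpair-step : ℕ × ℕ → ℕ × ℕ
unpair-step (zero  , b) = suc b , 0
unpair-step (suc a , b) = a , suc b

unpair-suc : ∀ n → unpair (suc n) ≡ unpair-step (unpair n)
unpair-suc n with unpair n
... | zero  , b = refl
... | suc a , b = refl

pair-suc-zero : ∀ b → ⟨ suc b , 0 ⟩ᴰ ≡ suc ⟨ 0 , b ⟩ᴰ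
pair-suc-zero b rewrite +-identityʳ b | +-identityʳ (suc (b + tri b)) =
  cong suc (+-comm b (tri b))

pair-suc-right : ∀ a b → ⟨ a , suc b ⟩ᴰ ≡ suc ⟨ suc a , b ⟩ᴰ
pair-suc-right a b rewrite +-suc a b = cong suc (+-suc (a + b + tri (a + b)) b)

unpair-pairᴰ : ∀ a b → unpair ⟨ a , b ⟩ᴰ ≡ (a , b)
unpair-pairᴰ a b = diagonal (a + b) b a refl
  where
  open ≡-Reasoning
  diagonal : ∀ s b a → a + b ≡ s → unpair ⟨ a , b ⟩ᴰ ≡ (a , b)
  diagonal s (suc b) a a+b≡s = begin
    unpair ⟨ a , suc b ⟩ᴰ                ≡⟨ cong unpair (pair-suc-right a b) ⟩
    unpair (suc ⟨ suc a , b ⟩ᴰ)          ≡⟨ unpair-suc ⟨ suc a , b ⟩ᴰ ⟩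
    unpair-step (unpair ⟨ suc a , b ⟩ᴰ)  ≡⟨ cong unpair-step (diagonal s b (suc a) (trans (sym (+-suc a b)) a+b≡s)) ⟩
    (a , suc b)                          ∎
  diagonal (suc s) zero (suc a) a+0≡s = begin
    unpair ⟨ suc a , 0 ⟩ᴰ                ≡⟨ cong unpair (pair-suc-zero a) ⟩
    unpair (suc ⟨ 0 , a ⟩ᴰ)              ≡⟨ unpair-suc ⟨ 0 , a ⟩ᴰ ⟩
    unpair-step (unpair ⟨ 0 , a ⟩ᴰ)      ≡⟨ cong unpair-step (diagonal s a 0 (trans (sym (+-identityʳ a)) (suc-injective a+0≡s))) ⟩
    (suc a , 0)                          ∎
  diagonal zero    zero zero    _  = refl
  diagonal (suc s) zero zero    ()
  diagonal zero    zero (suc a) ()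

-- Opaque, so that goals never unfold into Cantor-polynomial arithmetic:
-- everything below only uses unpair-pair.
opaque
  ⟨_,_⟩ : ℕ → ℕ → ℕ
  ⟨ a , b ⟩ = ⟨ a , b ⟩ᴰ

  ⟨,⟩≡⟨,⟩ᴰ : ∀ a b → ⟨ a , b ⟩ ≡ ⟨ a , b ⟩ᴰ
  ⟨,⟩≡⟨,⟩ᴰ a b = refl

π₁ π₂ : ℕ → ℕ
π₁ n = proj₁ (unpair n)
π₂ n = proj₂ (unpair n)

unpair-pair : ∀ a b → unpair ⟨ a , b ⟩ ≡ (a , b)
unpair-pair a b = trans (cong unpair (⟨,⟩≡⟨,⟩ᴰ a b)) (unpair-pairᴰ a b)

π₁-pair : ∀ a b → π₁ ⟨ a , b ⟩ ≡ a
π₁-pair a b = cong proj₁ (unpair-pair a b)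

π₂-pair : ∀ a b → π₂ ⟨ a , b ⟩ ≡ b
π₂-pair a b = cong proj₂ (unpair-pair a b)

pair-injective : ∀ {a b c d} → ⟨ a , b ⟩ ≡ ⟨ c , d ⟩ → a ≡ c × b ≡ d
pair-injective {a} {b} {c} {d} eq =
  trans (sym (π₁-pair a b)) (trans (cong π₁ eq) (π₁-pair c d)) ,
  trans (sym (π₂-pair a b)) (trans (cong π₂ eq) (π₂-pair c d))

π-≤ : ∀ n → π₁ n ≤ n × π₂ n ≤ n
π-≤ zero = z≤n , z≤n
π-≤ (suc n) with unpair n | π-≤ n
... | zero  , b | _     , b≤n = s≤s b≤n , z≤n
... | suc a , b | 1+a≤n , b≤n = ≤-trans (n≤1+n a) (m≤n⇒m≤1+n 1+a≤n) , s≤s b≤n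

suc-closed⇒≤-closed : (P : ℕ → Set) → (∀ {n} → P n → P (suc n)) → ∀ {m n} → m ≤ n → P m → P n
suc-closed⇒≤-closed P step m≤n = go (≤⇒≤′ m≤n)
  where
  go : ∀ {m n} → m ≤′ n → P m → P n
  go ≤′-refl        p = p
  go (≤′-step m≤′n) p = step (go m≤′n p)

>>=-just : ∀ {m : Maybe ℕ} {k : ℕ → Maybe ℕ} {y} → (m >>= k) ≡ just y → Σ ℕ λ u → m ≡ just u × k u ≡ just y
>>=-just {just u} eq = u , refl , eq

mutual
  eval-suc : ∀ n c x {y} → eval n c x ≡ just y → eval (suc n) c x ≡ just y
  eval-suc (suc n) Z   x eq = eq
  eval-suc (suc n) S   x eq = eq
  eval-suc (suc n) Id  x eq = eq
  eval-suc (suc n) Fst x eq = eq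
  eval-suc (suc n) Snd x eq = eq
  eval-suc (suc n) (Comp f g) x eq with >>=-just {eval n g x} eq
  ... | u , gx , fu rewrite eval-suc n g x gx = eval-suc n f u fu
  eval-suc (suc n) (Pair f g) x eq with >>=-just {eval n f x} eq
  ... | u , fx , rest with >>=-just {eval n g x} rest
  ... | v , gx , done rewrite eval-suc n f x fx | eval-suc n g x gx = done
  eval-suc (suc n) (Rec f g) x eq = evalRec-suc n f g _ _ eq
  eval-suc (suc n) (Mu f)    x eq = evalMu-suc n f x 0 eq

  evalRec-suc : ∀ n f g a m {y} → evalRec n f g a m ≡ just y → evalRec (suc n) f g a m ≡ just y
  evalRec-suc (suc n) f g a zero    eq = eval-suc n f a eq
  evalRec-suc (suc n) f g a (suc m) eq with >>=-just {evalRec n f g a m} eq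
  ... | r , rec , step rewrite evalRec-suc n f g a m rec = eval-suc n g _ step

  evalMu-suc : ∀ n f x i {y} → evalMu n f x i ≡ just y → evalMu (suc n) f x i ≡ just y
  evalMu-suc (suc n) f x i eq with >>=-just {eval n f ⟨ x , i ⟩ᴰ} eq
  ... | zero  , fx , done rewrite eval-suc n f _ fx = done
  ... | suc v , fx , rest rewrite eval-suc n f _ fx = evalMu-suc n f x (suc i) rest

eval-mono : ∀ {m n} c x {y} → m ≤ n → eval m c x ≡ just y → eval n c x ≡ just y
eval-mono c x {y} = suc-closed⇒≤-closed (λ n → eval n c x ≡ just y) (λ {n} → eval-suc n c x)

evalRec-mono : ∀ {m n} f g a k {y} → m ≤ n → evalRec m f g a k ≡ just y → evalRec n f g a k ≡ just y
evalRec-mono f g a k {y} = suc-closed⇒≤-closed (λ n → evalRec n f g a k ≡ just y) (λ {n} → evalRec-suc n f g a k)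

evalMu-mono : ∀ {m n} f x i {y} → m ≤ n → evalMu m f x i ≡ just y → evalMu n f x i ≡ just y
evalMu-mono f x i {y} = suc-closed⇒≤-closed (λ n → evalMu n f x i ≡ just y) (λ {n} → evalMu-suc n f x i)

-- e · x ↓ y  is, by definition,  Eval (decode e) x y.
Eval : Code → ℕ → ℕ → Set
Eval c x y = Σ ℕ λ fuel → eval fuel c x ≡ just y

EvalRec : Code → Code → ℕ → ℕ → ℕ → Set
EvalRec f g a m r = Σ ℕ λ fuel → evalRec fuel f g a m ≡ just r

EvalMu : Code → ℕ → ℕ → ℕ → Set
EvalMu f x i y = Σ ℕ λ fuel → evalMu fuel f x i ≡ just y

Eval-functional : ∀ {c x y y′} → Eval c x y → Eval c x y′ → y ≡ y′
Eval-functional {c} {x} (m , eq) (n , eq′) =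
  just-injective (trans (sym (eval-mono c x (m≤m⊔n m n) eq)) (eval-mono c x (m≤n⊔m m n) eq′))

Eval-Z : ∀ x → Eval Z x 0
Eval-Z x = 1 , refl

Eval-S : ∀ x → Eval S x (suc x)
Eval-S x = 1 , refl

Eval-Id : ∀ x → Eval Id x x
Eval-Id x = 1 , refl

Eval-Fst : ∀ a b → Eval Fst ⟨ a , b ⟩ a
Eval-Fst a b = 1 , cong just (π₁-pair a b)

Eval-Snd : ∀ a b → Eval Snd ⟨ a , b ⟩ b
Eval-Snd a b = 1 , cong just (π₂-pair a b)

Eval-Comp : ∀ {f g x u y} → Eval g x u → Eval f u y → Eval (Comp f g) x y
Eval-Comp {f} {g} {x} {u} (m , gx) (n , fu) = suc (m ⊔ n) , goal
  where
  goal : eval (suc (m ⊔ n)) (Comp f g) x ≡ just _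
  goal rewrite eval-mono g x (m≤m⊔n m n) gx = eval-mono f u (m≤n⊔m m n) fu

Eval-Pair : ∀ {f g x u v} → Eval f x u → Eval g x v → Eval (Pair f g) x ⟨ u , v ⟩
Eval-Pair {f} {g} {x} {u} {v} (m , fx) (n , gx) = suc (m ⊔ n) , goal
  where
  goal : eval (suc (m ⊔ n)) (Pair f g) x ≡ just ⟨ u , v ⟩
  goal rewrite eval-mono f x (m≤m⊔n m n) fx | eval-mono g x (m≤n⊔m m n) gx = cong just (sym (⟨,⟩≡⟨,⟩ᴰ u v))

EvalRec-zero : ∀ {f g a r} → Eval f a r → EvalRec f g a 0 r
EvalRec-zero (n , fa) = suc n , fa

EvalRec-suc : ∀ {f g a m r r′} → EvalRec f g a m r → Eval g ⟨ ⟨ a , m ⟩ , r ⟩ r′ → EvalRec f g a (suc m) r′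
EvalRec-suc {f} {g} {a} {m} {r} (n , rec) (k , step) = suc (n ⊔ k) , goal
  where
  goal : evalRec (suc (n ⊔ k)) f g a (suc m) ≡ just _
  goal rewrite evalRec-mono f g a m (m≤m⊔n n k) rec | sym (⟨,⟩≡⟨,⟩ᴰ a m) | sym (⟨,⟩≡⟨,⟩ᴰ ⟨ a , m ⟩ r) =
    eval-mono g _ (m≤n⊔m n k) step

Eval-Rec : ∀ {f g a m r} → EvalRec f g a m r → Eval (Rec f g) ⟨ a , m ⟩ r
Eval-Rec {a = a} {m} (n , rec) =
  suc n , subst (λ p → evalRec n _ _ (proj₁ p) (proj₂ p) ≡ just _) (sym (unpair-pair a m)) rec

EvalMu-zero : ∀ {f x i} → Eval f ⟨ x , i ⟩ 0 → EvalMu f x i i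
EvalMu-zero {f} {x} {i} (n , fx) = suc n , goal
  where
  goal : evalMu (suc n) f x i ≡ just i
  goal rewrite sym (⟨,⟩≡⟨,⟩ᴰ x i) | fx = refl

EvalMu-suc : ∀ {f x i v y} → Eval f ⟨ x , i ⟩ (suc v) → EvalMu f x (suc i) y → EvalMu f x i y
EvalMu-suc {f} {x} {i} {v} (n , fx) (k , rest) = suc (n ⊔ k) , goal
  where
  goal : evalMu (suc (n ⊔ k)) f x i ≡ just _
  goal rewrite sym (⟨,⟩≡⟨,⟩ᴰ x i) | eval-mono f ⟨ x , i ⟩ (m≤m⊔n n k) fx =
    evalMu-mono f x (suc i) (m≤n⊔m n k) rest

Eval-Mu : ∀ {f x y} → EvalMu f x 0 y → Eval (Mu f) x y
Eval-Mu (n , mu) = suc n , mu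

decodeDigit : ℕ → ℕ → Code
decodeDigit 0 r = Z
decodeDigit 1 r = S
decodeDigit 2 r = Id
decodeDigit 3 r = Fst
decodeDigit 4 r = Snd
decodeDigit 5 r = Comp (decode (π₁ r)) (decode (π₂ r))
decodeDigit 6 r = Pair (decode (π₁ r)) (decode (π₂ r))
decodeDigit 7 r = Rec  (decode (π₁ r)) (decode (π₂ r))
decodeDigit _ r = Mu   (decode r)

mutual
  decodeF-stable : ∀ f g u → u < f → u < g → decodeF f u ≡ decodeF g u
  decodeF-stable (suc f) (suc g) zero    _         _         = refl
  decodeF-stable (suc f) (suc g) (suc u) (s≤s u<f) (s≤s u<g)
    with suc u % 9 | suc u / 9 | m/n<m (suc u) 9 (s≤s (s≤s z≤n))
  ... | 0 | r | r<u = refl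
  ... | 1 | r | r<u = refl
  ... | 2 | r | r<u = refl
  ... | 3 | r | r<u = refl
  ... | 4 | r | r<u = refl
  ... | 5 | r | r<u = cong₂ Comp (decodeF-stable-π₁ u<f u<g r<u) (decodeF-stable-π₂ u<f u<g r<u)
  ... | 6 | r | r<u = cong₂ Pair (decodeF-stable-π₁ u<f u<g r<u) (decodeF-stable-π₂ u<f u<g r<u)
  ... | 7 | r | r<u = cong₂ Rec  (decodeF-stable-π₁ u<f u<g r<u) (decodeF-stable-π₂ u<f u<g r<u)
  ... | suc (suc (suc (suc (suc (suc (suc (suc _))))))) | r | r<u =
    cong Mu (decodeF-stable f g r (≤-trans r<u u<f) (≤-trans r<u u<g))

  decodeF-stable-π₁ : ∀ {f g u r} → u < f → u < g → r < suc u → decodeF f (π₁ r) ≡ decodeF g (π₁ r)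
  decodeF-stable-π₁ {f} {g} {r = r} u<f u<g r<u =
    decodeF-stable f g _ (≤-<-trans (proj₁ (π-≤ r)) (≤-trans r<u u<f)) (≤-<-trans (proj₁ (π-≤ r)) (≤-trans r<u u<g))

  decodeF-stable-π₂ : ∀ {f g u r} → u < f → u < g → r < suc u → decodeF f (π₂ r) ≡ decodeF g (π₂ r)
  decodeF-stable-π₂ {f} {g} {r = r} u<f u<g r<u =
    decodeF-stable f g _ (≤-<-trans (proj₂ (π-≤ r)) (≤-trans r<u u<f)) (≤-<-trans (proj₂ (π-≤ r)) (≤-trans r<u u<g))

decodeF-decode : ∀ f u → u < f → decodeF f u ≡ decode u
decodeF-decode f u u<f = decodeF-stable f (suc u) u u<f ≤-refl

decode-unfold : ∀ c → decode c ≡ decodeDigit (c % 9) (c / 9)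
decode-unfold zero = refl
decode-unfold (suc c) with suc c % 9 | m%n<n (suc c) 9 | suc c / 9 | m/n<m (suc c) 9 (s≤s (s≤s z≤n))
... | 0 | _ | r | r<c = refl
... | 1 | _ | r | r<c = refl
... | 2 | _ | r | r<c = refl
... | 3 | _ | r | r<c = refl
... | 4 | _ | r | r<c = refl
... | 5 | _ | r | r<c = cong₂ Comp (decodeF-decode (suc c) _ (≤-<-trans (proj₁ (π-≤ r)) r<c))
                                   (decodeF-decode (suc c) _ (≤-<-trans (proj₂ (π-≤ r)) r<c))
... | 6 | _ | r | r<c = cong₂ Pair (decodeF-decode (suc c) _ (≤-<-trans (proj₁ (π-≤ r)) r<c))
                                   (decodeF-decode (suc c) _ (≤-<-trans (proj₂ (π-≤ r)) r<c))
... | 7 | _ | r | r<c = cong₂ Rec (decodeF-decode (suc c) _ (≤-<-trans (proj₁ (π-≤ r)) r<c))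
                                  (decodeF-decode (suc c) _ (≤-<-trans (proj₂ (π-≤ r)) r<c))
... | 8 | _ | r | r<c = cong Mu (decodeF-decode (suc c) r r<c)
... | suc (suc (suc (suc (suc (suc (suc (suc (suc _)))))))) | s≤s (s≤s (s≤s (s≤s (s≤s (s≤s (s≤s (s≤s (s≤s ())))))))) | _ | _

decode-digit : ∀ t {t<9 : True (t <? 9)} r → decode (t + r * 9) ≡ decodeDigit t r
decode-digit t {t<9} r = trans (decode-unfold (t + r * 9)) (cong₂ decodeDigit remainder quotient)
  where
  remainder : (t + r * 9) % 9 ≡ t
  remainder = trans ([m+kn]%n≡m%n t r 9) (m<n⇒m%n≡m (toWitness t<9))
  quotient : (t + r * 9) / 9 ≡ r
  quotient = trans (+-distrib-/-∣ʳ t (n∣m*n r)) (cong₂ _+_ (m<n⇒m/n≡0 (toWitness t<9)) (m*n/n≡m r 9))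

comp# pair# rec# : ℕ → ℕ → ℕ
comp# u w = 5 + ⟨ u , w ⟩ * 9
pair# u w = 6 + ⟨ u , w ⟩ * 9
rec#  u w = 7 + ⟨ u , w ⟩ * 9

decode-comp# : ∀ u w → decode (comp# u w) ≡ Comp (decode u) (decode w)
decode-comp# u w = trans (decode-digit 5 ⟨ u , w ⟩) (cong₂ Comp (cong decode (π₁-pair u w)) (cong decode (π₂-pair u w)))

decode-pair# : ∀ u w → decode (pair# u w) ≡ Pair (decode u) (decode w)
decode-pair# u w = trans (decode-digit 6 ⟨ u , w ⟩) (cong₂ Pair (cong decode (π₁-pair u w)) (cong decode (π₂-pair u w)))

decode-rec# : ∀ u w → decode (rec# u w) ≡ Rec (decode u) (decode w)
decode-rec# u w = trans (decode-digit 7 ⟨ u , w ⟩) (cong₂ Rec (cong decode (π₁-pair u w)) (cong decode (π₂-pair u w)))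

encode : Code → ℕ
encode Z          = 0
encode S          = 1
encode Id         = 2
encode Fst        = 3
encode Snd        = 4
encode (Comp f g) = comp# (encode f) (encode g)
encode (Pair f g) = pair# (encode f) (encode g)
encode (Rec f g)  = rec# (encode f) (encode g)
encode (Mu f)     = 8 + encode f * 9

decode-encode : ∀ c → decode (encode c) ≡ c
decode-encode Z          = refl
decode-encode S          = refl
decode-encode Id         = refl
decode-encode Fst        = refl
decode-encode Snd        = refl
decode-encode (Comp f g) = trans (decode-comp# _ _) (cong₂ Comp (decode-encode f) (decode-encode g))
decode-encode (Pair f g) = trans (decode-pair# _ _) (cong₂ Pair (decode-encode f) (decode-encode g))
decode-encode (Rec f g)  = trans (decode-rec# _ _) (cong₂ Rec (decode-encode f) (decode-encode g))
decode-encode (Mu f)     = trans (decode-digit 8 (encode f)) (cong Mu (decode-encode f))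

encode-↓ : ∀ {c x y} → Eval c x y → encode c · x ↓ y
encode-↓ {c} {x} {y} = subst (λ k → Eval k x y) (sym (decode-encode c))

-- Total terms and their compilation

data Tm : Set where
  zT sT idT fstT sndT : Tm
  _∘T_   : Tm → Tm → Tm
  ⟪_,_⟫  : Tm → Tm → Tm
  recT   : Tm → Tm → Tm
  ifzT   : Tm → Tm → Tm → Tm
  predT  : Tm → Tm
  plusT  : Tm → Tm → Tm
  mul9T  : Tm → Tm
  dm9T   : Tm → Tm
  constT : ℕ → Tm
infixr 9 _∘T_

ifz : ℕ → ℕ → ℕ → ℕ
ifz zero    u v = u
ifz (suc _) u v = v

mutual
  ⟦_⟧ : Tm → ℕ → ℕ
  ⟦ zT ⟧         x = 0
  ⟦ sT ⟧         x = suc x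
  ⟦ idT ⟧        x = x
  ⟦ fstT ⟧       x = π₁ x
  ⟦ sndT ⟧       x = π₂ x
  ⟦ f ∘T g ⟧     x = ⟦ f ⟧ (⟦ g ⟧ x)
  ⟦ ⟪ f , g ⟫ ⟧  x = ⟨ ⟦ f ⟧ x , ⟦ g ⟧ x ⟩
  ⟦ recT f g ⟧   x = ⟦rec⟧ f g (π₁ x) (π₂ x)
  ⟦ ifzT b u v ⟧ x = ifz (⟦ b ⟧ x) (⟦ u ⟧ x) (⟦ v ⟧ x)
  ⟦ predT f ⟧    x = pred (⟦ f ⟧ x)
  ⟦ plusT f g ⟧  x = ⟦ f ⟧ x + ⟦ g ⟧ x
  ⟦ mul9T f ⟧    x = ⟦ f ⟧ x * 9
  ⟦ dm9T f ⟧     x = ⟨ ⟦ f ⟧ x / 9 , 8 ∸ ⟦ f ⟧ x % 9 ⟩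
  ⟦ constT n ⟧   x = n

  ⟦rec⟧ : Tm → Tm → ℕ → ℕ → ℕ
  ⟦rec⟧ f g a zero    = ⟦ f ⟧ a
  ⟦rec⟧ f g a (suc m) = ⟦ g ⟧ ⟨ ⟨ a , m ⟩ , ⟦rec⟧ f g a m ⟩

iterS : ℕ → Code → Code
iterS zero    c = c
iterS (suc n) c = Comp S (iterS n c)

IFZ PRED ADD MUL9 DM : Code
IFZ  = Rec Fst (Comp Snd (Comp Fst Fst))
PRED = Rec Z (Comp Snd Fst)
ADD  = Rec Id (Comp S Snd)
MUL9 = Rec Z (iterS 9 Snd)
-- The digit is counted down from 8, which needs only a test for zero.
DM = Rec (Pair Z (iterS 8 Z)) (Comp (Comp IFZ (Pair (Pair (Pair (Comp S Fst) (iterS 8 Z))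
                                                       (Pair Fst (Comp PRED (Pair Z Snd))))
                                                 Snd))
                                    Snd)

compile : Tm → Code
compile zT           = Z
compile sT           = S
compile idT          = Id
compile fstT         = Fst
compile sndT         = Snd
compile (f ∘T g)     = Comp (compile f) (compile g)
compile ⟪ f , g ⟫    = Pair (compile f) (compile g)
compile (recT f g)   = Rec (compile f) (compile g)
compile (ifzT b u v) = Comp IFZ (Pair (Pair (compile u) (compile v)) (compile b))
compile (predT f)    = Comp PRED (Pair Z (compile f))
compile (plusT f g)  = Comp ADD (Pair (compile f) (compile g))
compile (mul9T f)    = Comp MUL9 (Pair Z (compile f))
compile (dm9T f)     = Comp DM (Pair Z (compile f))
compile (constT n)   = iterS n Z

Eval-iterS : ∀ n {c x y} → Eval c x y → Eval (iterS n c) x (n + y)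
Eval-iterS zero    cx = cx
Eval-iterS (suc n) cx = Eval-Comp (Eval-iterS n cx) (Eval-S _)

Eval-IFZ : ∀ u v m → Eval IFZ ⟨ ⟨ u , v ⟩ , m ⟩ (ifz m u v)
Eval-IFZ u v m = Eval-Rec (go m)
  where
  go : ∀ m → EvalRec Fst (Comp Snd (Comp Fst Fst)) ⟨ u , v ⟩ m (ifz m u v)
  go zero    = EvalRec-zero (Eval-Fst u v)
  go (suc m) = EvalRec-suc (go m) (Eval-Comp (Eval-Comp (Eval-Fst _ _) (Eval-Fst _ _)) (Eval-Snd u v))

Eval-PRED : ∀ m → Eval PRED ⟨ 0 , m ⟩ (pred m)
Eval-PRED m = Eval-Rec (go m)
  where
  go : ∀ m → EvalRec Z (Comp Snd Fst) 0 m (pred m)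
  go zero    = EvalRec-zero (Eval-Z 0)
  go (suc m) = EvalRec-suc (go m) (Eval-Comp (Eval-Fst _ _) (Eval-Snd 0 m))

Eval-ADD : ∀ a m → Eval ADD ⟨ a , m ⟩ (a + m)
Eval-ADD a m = Eval-Rec (go m)
  where
  go : ∀ m → EvalRec Id (Comp S Snd) a m (a + m)
  go zero    = subst (EvalRec Id (Comp S Snd) a 0) (sym (+-identityʳ a)) (EvalRec-zero (Eval-Id a))
  go (suc m) = subst (EvalRec Id (Comp S Snd) a (suc m)) (sym (+-suc a m))
                     (EvalRec-suc (go m) (Eval-Comp (Eval-Snd ⟨ a , m ⟩ (a + m)) (Eval-S _)))

Eval-MUL9 : ∀ m → Eval MUL9 ⟨ 0 , m ⟩ (m * 9)
Eval-MUL9 m = Eval-Rec (go m)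
  where
  go : ∀ m → EvalRec Z (iterS 9 Snd) 0 m (m * 9)
  go zero    = EvalRec-zero (Eval-Z 0)
  go (suc m) = EvalRec-suc (go m) (Eval-iterS 9 (Eval-Snd ⟨ 0 , m ⟩ (m * 9)))

divMod9-step : ℕ × ℕ → ℕ × ℕ
divMod9-step (q , zero)  = suc q , 8
divMod9-step (q , suc d) = q , d

divMod9-count : ℕ → ℕ × ℕ
divMod9-count zero    = 0 , 8
divMod9-count (suc n) = divMod9-step (divMod9-count n)

mutual
  divMod9-count-multiple : ∀ q → divMod9-count (q * 9) ≡ (q , 8)
  divMod9-count-multiple zero    = refl
  divMod9-count-multiple (suc q) = trans (cong (divMod9-count ∘ suc) (+-comm 8 (q * 9)))
                                         (cong divMod9-step (divMod9-count-digit q 8 ≤-refl))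

  divMod9-count-digit : ∀ q t → t ≤ 8 → divMod9-count (q * 9 + t) ≡ (q , 8 ∸ t)
  divMod9-count-digit q zero    _         = trans (cong divMod9-count (+-identityʳ (q * 9))) (divMod9-count-multiple q)
  divMod9-count-digit q (suc t) (s≤s t≤7) = begin
    divMod9-count (q * 9 + suc t)       ≡⟨ cong divMod9-count (+-suc (q * 9) t) ⟩
    divMod9-step (divMod9-count (q * 9 + t)) ≡⟨ cong divMod9-step (divMod9-count-digit q t (m≤n⇒m≤1+n t≤7)) ⟩
    divMod9-step (q , 8 ∸ t)            ≡⟨ cong (λ d → divMod9-step (q , d)) (+-∸-assoc 1 t≤7) ⟩
    (q , 7 ∸ t)                         ∎
    where open ≡-Reasoning

divMod9-count-correct : ∀ c → divMod9-count c ≡ (c / 9 , 8 ∸ c % 9)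
divMod9-count-correct c = begin
  divMod9-count c                     ≡⟨ cong divMod9-count (trans (m≡m%n+[m/n]*n c 9) (+-comm (c % 9) _)) ⟩
  divMod9-count (c / 9 * 9 + c % 9)   ≡⟨ divMod9-count-digit (c / 9) (c % 9) (≤-pred (m%n<n c 9)) ⟩
  (c / 9 , 8 ∸ c % 9)                 ∎
  where open ≡-Reasoning

Eval-DM : ∀ c → Eval DM ⟨ 0 , c ⟩ ⟨ c / 9 , 8 ∸ c % 9 ⟩
Eval-DM c = subst (Eval DM ⟨ 0 , c ⟩) (cong pairUp (divMod9-count-correct c)) (Eval-Rec (go c))
  where
  pairUp : ℕ × ℕ → ℕ
  pairUp (q , d) = ⟨ q , d ⟩
  step : ∀ q d → Eval _ ⟨ q , d ⟩ (pairUp (divMod9-step (q , d)))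
  step q d = Eval-Comp (Eval-Pair (Eval-Pair (Eval-Pair (Eval-Comp (Eval-Fst q d) (Eval-S q)) (Eval-iterS 8 (Eval-Z _)))
                                             (Eval-Pair (Eval-Fst q d) (Eval-Comp (Eval-Pair (Eval-Z _) (Eval-Snd q d)) (Eval-PRED d))))
                                  (Eval-Snd q d))
                       (subst (Eval IFZ _) (ifz-step d) (Eval-IFZ _ _ d))
    where
    ifz-step : ∀ d → ifz d ⟨ suc q , 8 ⟩ ⟨ q , pred d ⟩ ≡ pairUp (divMod9-step (q , d))
    ifz-step zero    = refl
    ifz-step (suc d) = refl
  go : ∀ m → EvalRec (Pair Z (iterS 8 Z)) _ 0 m (pairUp (divMod9-count m))
  go zero    = EvalRec-zero (Eval-Pair (Eval-Z 0) (Eval-iterS 8 (Eval-Z 0)))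
  go (suc m) = EvalRec-suc (go m) (Eval-Comp (Eval-Snd ⟨ 0 , m ⟩ _) (step _ _))

compile-correct : ∀ t x → Eval (compile t) x (⟦ t ⟧ x)
compile-correct zT           x = Eval-Z x
compile-correct sT           x = Eval-S x
compile-correct idT          x = Eval-Id x
compile-correct fstT         x = 1 , refl
compile-correct sndT         x = 1 , refl
compile-correct (f ∘T g)     x = Eval-Comp (compile-correct g x) (compile-correct f _)
compile-correct ⟪ f , g ⟫    x = Eval-Pair (compile-correct f x) (compile-correct g x)
compile-correct (recT f g)   x = let (n , rec) = go (π₁ x) (π₂ x) in suc n , rec
  where
  go : ∀ a m → EvalRec (compile f) (compile g) a m (⟦rec⟧ f g a m)
  go a zero    = EvalRec-zero (compile-correct f a)
  go a (suc m) = EvalRec-suc (go a m) (compile-correct g _)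
compile-correct (ifzT b u v) x = Eval-Comp (Eval-Pair (Eval-Pair (compile-correct u x) (compile-correct v x)) (compile-correct b x))
                                           (Eval-IFZ (⟦ u ⟧ x) (⟦ v ⟧ x) (⟦ b ⟧ x))
compile-correct (predT f)    x = Eval-Comp (Eval-Pair (Eval-Z x) (compile-correct f x)) (Eval-PRED (⟦ f ⟧ x))
compile-correct (plusT f g)  x = Eval-Comp (Eval-Pair (compile-correct f x) (compile-correct g x)) (Eval-ADD (⟦ f ⟧ x) (⟦ g ⟧ x))
compile-correct (mul9T f)    x = Eval-Comp (Eval-Pair (Eval-Z x) (compile-correct f x)) (Eval-MUL9 (⟦ f ⟧ x))
compile-correct (dm9T f)     x = Eval-Comp (Eval-Pair (Eval-Z x) (compile-correct f x)) (Eval-DM (⟦ f ⟧ x))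
compile-correct (constT n)   x = subst (Eval (iterS n Z) x) (+-identityʳ n) (Eval-iterS n (Eval-Z x))

compile-correct′ : ∀ t x {y} → ⟦ t ⟧ x ≡ y → Eval (compile t) x y
compile-correct′ t x refl = compile-correct t x

-- A universal code

-- A small-step machine for codes, with states and stacks encoded as numbers:
-- ⟨ 0 , ⟨ c , ⟨ x , K ⟩ ⟩ ⟩ evaluates decode c on x, ⟨ 1 , ⟨ y , K ⟩ ⟩ returns y to
-- the stack K, and a stack is 0 or suc ⟨ frame , K ⟩.  Its step function is total.
evalState : ℕ → ℕ → ℕ → ℕ
evalState c x K = ⟨ 0 , ⟨ c , ⟨ x , K ⟩ ⟩ ⟩

returnState : ℕ → ℕ → ℕ
returnState y K = ⟨ 1 , ⟨ y , K ⟩ ⟩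

emptyStack : ℕ
emptyStack = 0

push : ℕ → ℕ → ℕ
push frame K = suc ⟨ frame , K ⟩

compFrame : ℕ → ℕ
compFrame u = ⟨ 0 , u ⟩

pairFrame₁ : ℕ → ℕ → ℕ
pairFrame₁ w x = ⟨ 1 , ⟨ w , x ⟩ ⟩

pairFrame₂ : ℕ → ℕ
pairFrame₂ a = ⟨ 2 , a ⟩

-- the value returned to it is R(a , i), and j more iterations are to be done
recFrame : ℕ → ℕ → ℕ → ℕ → ℕ
recFrame w a i j = ⟨ 3 , ⟨ w , ⟨ a , ⟨ i , j ⟩ ⟩ ⟩ ⟩

muFrame : ℕ → ℕ → ℕ → ℕ
muFrame u x i = ⟨ 4 , ⟨ u , ⟨ x , i ⟩ ⟩ ⟩

evalStateT : Tm → Tm → Tm → Tm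
evalStateT c x K = ⟪ zT , ⟪ c , ⟪ x , K ⟫ ⟫ ⟫

returnStateT : Tm → Tm → Tm
returnStateT y K = ⟪ constT 1 , ⟪ y , K ⟫ ⟫

pushT : Tm → Tm → Tm
pushT frame K = sT ∘T ⟪ frame , K ⟫

caseT : Tm → Tm → List Tm → Tm
caseT s d []       = d
caseT s d (b ∷ bs) = ifzT s b (caseT (predT s) d bs)

codeT argT stackT quotientT digitT left′T right′T : Tm
codeT     = fstT ∘T sndT
argT      = fstT ∘T sndT ∘T sndT
stackT    = sndT ∘T sndT ∘T sndT
quotientT = fstT ∘T dm9T codeT
digitT    = sndT ∘T dm9T codeT
left′T    = fstT ∘T quotientT
right′T   = sndT ∘T quotientT

-- digitT is 8 ∸ (code % 9), so the branches run from Mu down to Z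
evalStepT : Tm
evalStepT = caseT digitT (returnStateT zT stackT)
  ( evalStateT quotientT ⟪ argT , zT ⟫ (pushT ⟪ constT 4 , ⟪ quotientT , ⟪ argT , zT ⟫ ⟫ ⟫ stackT)
  ∷ evalStateT left′T (fstT ∘T argT) (pushT ⟪ constT 3 , ⟪ right′T , ⟪ fstT ∘T argT , ⟪ zT , sndT ∘T argT ⟫ ⟫ ⟫ ⟫ stackT)
  ∷ evalStateT left′T argT (pushT ⟪ constT 1 , ⟪ right′T , argT ⟫ ⟫ stackT)
  ∷ evalStateT right′T argT (pushT ⟪ zT , left′T ⟫ stackT)
  ∷ returnStateT (sndT ∘T argT) stackT
  ∷ returnStateT (fstT ∘T argT) stackT
  ∷ returnStateT argT stackT
  ∷ returnStateT (sT ∘T argT) stackT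
  ∷ [])

valueT returnStackT frameT restT tagT dataT : Tm
valueT       = fstT ∘T sndT
returnStackT = sndT ∘T sndT
frameT       = fstT ∘T predT returnStackT
restT        = sndT ∘T predT returnStackT
tagT         = fstT ∘T frameT
dataT        = sndT ∘T frameT

returnStepT : Tm
returnStepT = caseT tagT
  (ifzT valueT (returnStateT (sndT ∘T sndT ∘T dataT) restT)
               (evalStateT (fstT ∘T dataT) ⟪ fstT ∘T sndT ∘T dataT , sT ∘T sndT ∘T sndT ∘T dataT ⟫
                 (pushT ⟪ constT 4 , ⟪ fstT ∘T dataT , ⟪ fstT ∘T sndT ∘T dataT , sT ∘T sndT ∘T sndT ∘T dataT ⟫ ⟫ ⟫ restT)))
  ( evalStateT dataT valueT restT
  ∷ evalStateT (fstT ∘T dataT) (sndT ∘T dataT) (pushT ⟪ constT 2 , valueT ⟫ restT)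
  ∷ returnStateT ⟪ dataT , valueT ⟫ restT
  ∷ ifzT (sndT ∘T sndT ∘T sndT ∘T dataT) (returnStateT valueT restT)
         (evalStateT (fstT ∘T dataT) ⟪ ⟪ fstT ∘T sndT ∘T dataT , fstT ∘T sndT ∘T sndT ∘T dataT ⟫ , valueT ⟫
           (pushT ⟪ constT 3 , ⟪ fstT ∘T dataT , ⟪ fstT ∘T sndT ∘T dataT ,
                    ⟪ sT ∘T fstT ∘T sndT ∘T sndT ∘T dataT , predT (sndT ∘T sndT ∘T sndT ∘T dataT) ⟫ ⟫ ⟫ ⟫ restT))
  ∷ [])

stepT : Tm
stepT = ifzT fstT evalStepT (ifzT returnStackT idT returnStepT)

step : ℕ → ℕ
step = ⟦ stepT ⟧

evalStep : ℕ → ℕ → ℕ → ℕ → ℕ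
evalStep 0 r x K = returnState 0 K
evalStep 1 r x K = returnState (suc x) K
evalStep 2 r x K = returnState x K
evalStep 3 r x K = returnState (π₁ x) K
evalStep 4 r x K = returnState (π₂ x) K
evalStep 5 r x K = evalState (π₂ r) x (push (compFrame (π₁ r)) K)
evalStep 6 r x K = evalState (π₁ r) x (push (pairFrame₁ (π₂ r) x) K)
evalStep 7 r x K = evalState (π₁ r) (π₁ x) (push (recFrame (π₂ r) (π₁ x) 0 (π₂ x)) K)
evalStep _ r x K = evalState r ⟨ x , 0 ⟩ (push (muFrame r x 0) K)

step-eval : ∀ c x K → step (evalState c x K) ≡ evalStep (c % 9) (c / 9) x K
step-eval c x K rewrite unpair-pair 0 ⟨ c , ⟨ x , K ⟩ ⟩ | unpair-pair c ⟨ x , K ⟩ | unpair-pair x K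
                      | unpair-pair (c / 9) (8 ∸ c % 9) with c % 9 | m%n<n c 9
... | 0 | _ = refl
... | 1 | _ = refl
... | 2 | _ = refl
... | 3 | _ = refl
... | 4 | _ = refl
... | 5 | _ = refl
... | 6 | _ = refl
... | 7 | _ = refl
... | 8 | _ = refl
... | suc (suc (suc (suc (suc (suc (suc (suc (suc _)))))))) | s≤s (s≤s (s≤s (s≤s (s≤s (s≤s (s≤s (s≤s (s≤s ()))))))))

step-comp : ∀ y u K → step (returnState y (push (compFrame u) K)) ≡ evalState u y K
step-comp y u K rewrite unpair-pair 1 ⟨ y , push (compFrame u) K ⟩ | unpair-pair y (push (compFrame u) K)
  | unpair-pair (compFrame u) K | unpair-pair 0 u = refl

step-pair₁ : ∀ y w x K → step (returnState y (push (pairFrame₁ w x) K)) ≡ evalState w x (push (pairFrame₂ y) K)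
step-pair₁ y w x K rewrite unpair-pair 1 ⟨ y , push (pairFrame₁ w x) K ⟩ | unpair-pair y (push (pairFrame₁ w x) K)
  | unpair-pair (pairFrame₁ w x) K | unpair-pair 1 ⟨ w , x ⟩ | unpair-pair w x = refl

step-pair₂ : ∀ y a K → step (returnState y (push (pairFrame₂ a) K)) ≡ returnState ⟨ a , y ⟩ K
step-pair₂ y a K rewrite unpair-pair 1 ⟨ y , push (pairFrame₂ a) K ⟩ | unpair-pair y (push (pairFrame₂ a) K)
  | unpair-pair (pairFrame₂ a) K | unpair-pair 2 a = refl

step-rec-done : ∀ y w a i K → step (returnState y (push (recFrame w a i 0) K)) ≡ returnState y K
step-rec-done y w a i K rewrite unpair-pair 1 ⟨ y , push (recFrame w a i 0) K ⟩ | unpair-pair y (push (recFrame w a i 0) K)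
  | unpair-pair (recFrame w a i 0) K | unpair-pair 3 ⟨ w , ⟨ a , ⟨ i , 0 ⟩ ⟩ ⟩ | unpair-pair w ⟨ a , ⟨ i , 0 ⟩ ⟩
  | unpair-pair a ⟨ i , 0 ⟩ | unpair-pair i 0 = refl

step-rec-next : ∀ y w a i j K →
  step (returnState y (push (recFrame w a i (suc j)) K)) ≡ evalState w ⟨ ⟨ a , i ⟩ , y ⟩ (push (recFrame w a (suc i) j) K)
step-rec-next y w a i j K rewrite unpair-pair 1 ⟨ y , push (recFrame w a i (suc j)) K ⟩
  | unpair-pair y (push (recFrame w a i (suc j)) K) | unpair-pair (recFrame w a i (suc j)) K
  | unpair-pair 3 ⟨ w , ⟨ a , ⟨ i , suc j ⟩ ⟩ ⟩ | unpair-pair w ⟨ a , ⟨ i , suc j ⟩ ⟩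
  | unpair-pair a ⟨ i , suc j ⟩ | unpair-pair i (suc j) = refl

step-mu-found : ∀ u x i K → step (returnState 0 (push (muFrame u x i) K)) ≡ returnState i K
step-mu-found u x i K rewrite unpair-pair 1 ⟨ 0 , push (muFrame u x i) K ⟩ | unpair-pair 0 (push (muFrame u x i) K)
  | unpair-pair (muFrame u x i) K | unpair-pair 4 ⟨ u , ⟨ x , i ⟩ ⟩ | unpair-pair u ⟨ x , i ⟩ | unpair-pair x i = refl

step-mu-next : ∀ v u x i K →
  step (returnState (suc v) (push (muFrame u x i) K)) ≡ evalState u ⟨ x , suc i ⟩ (push (muFrame u x (suc i)) K)
step-mu-next v u x i K rewrite unpair-pair 1 ⟨ suc v , push (muFrame u x i) K ⟩
  | unpair-pair (suc v) (push (muFrame u x i) K) | unpair-pair (muFrame u x i) K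
  | unpair-pair 4 ⟨ u , ⟨ x , i ⟩ ⟩ | unpair-pair u ⟨ x , i ⟩ | unpair-pair x i = refl

run : ℕ → ℕ → ℕ
run zero    s = s
run (suc t) s = step (run t s)

run-+ : ∀ a b s → run (a + b) s ≡ run a (run b s)
run-+ zero    b s = refl
run-+ (suc a) b s = cong step (run-+ a b s)

_↠_ : ℕ → ℕ → Set
s ↠ s′ = Σ ℕ λ t → run t s ≡ s′

↠-refl : ∀ {s} → s ↠ s
↠-refl = 0 , refl

↠-step : ∀ {s s′} → step s ≡ s′ → s ↠ s′
↠-step eq = 1 , eq

infixr 4 _▸_
_▸_ : ∀ {s s₁ s₂} → s ↠ s₁ → s₁ ↠ s₂ → s ↠ s₂
_▸_ {s} (t₁ , eq₁) (t₂ , eq₂) = t₂ + t₁ , trans (run-+ t₂ t₁ s) (trans (cong (run t₂) eq₁) eq₂)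

mutual
  eval⇒↠ : ∀ n c x {y} K → eval n (decode c) x ≡ just y → evalState c x K ↠ returnState y K
  eval⇒↠ (suc n) c x K eq =
    ↠-step (step-eval c x K)
    ▸ evalDigit⇒↠ n (c % 9) (c / 9) x K (subst (λ d → eval (suc n) d x ≡ just _) (decode-unfold c) eq)

  evalDigit⇒↠ : ∀ n t r x {y} K → eval (suc n) (decodeDigit t r) x ≡ just y →
                evalStep t r x K ↠ returnState y K
  evalDigit⇒↠ n 0 r x K refl = ↠-refl
  evalDigit⇒↠ n 1 r x K refl = ↠-refl
  evalDigit⇒↠ n 2 r x K refl = ↠-refl
  evalDigit⇒↠ n 3 r x K refl = ↠-refl
  evalDigit⇒↠ n 4 r x K refl = ↠-refl
  evalDigit⇒↠ n 5 r x K eq with >>=-just {eval n (decode (π₂ r)) x} eq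
  ... | u , gx , fu = eval⇒↠ n (π₂ r) x _ gx ▸ ↠-step (step-comp u (π₁ r) K) ▸ eval⇒↠ n (π₁ r) u K fu
  evalDigit⇒↠ n 6 r x K eq with >>=-just {eval n (decode (π₁ r)) x} eq
  ... | a , fx , rest with >>=-just {eval n (decode (π₂ r)) x} rest
  ... | b , gx , refl = subst (λ v → _ ↠ returnState v K) (⟨,⟩≡⟨,⟩ᴰ a b)
         (eval⇒↠ n (π₁ r) x _ fx ▸ ↠-step (step-pair₁ a (π₂ r) x K)
          ▸ eval⇒↠ n (π₂ r) x _ gx ▸ ↠-step (step-pair₂ b a K))
  evalDigit⇒↠ n 7 r x {y} K eq =
    subst (λ j → evalState (π₁ r) (π₁ x) (push (recFrame (π₂ r) (π₁ x) 0 j) K)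
                 ↠ returnState y (push (recFrame (π₂ r) (π₁ x) (π₂ x) 0) K))
          (+-identityʳ (π₂ x)) (evalRec⇒↠ n (π₁ r) (π₂ r) (π₁ x) (π₂ x) 0 K eq)
    ▸ ↠-step (step-rec-done y (π₂ r) (π₁ x) (π₂ x) K)
  evalDigit⇒↠ n (suc (suc (suc (suc (suc (suc (suc (suc _)))))))) r x K eq = evalMu⇒↠ n r x 0 K eq

  evalRec⇒↠ : ∀ n u w a m {r} j K → evalRec n (decode u) (decode w) a m ≡ just r →
              evalState u a (push (recFrame w a 0 (m + j)) K) ↠ returnState r (push (recFrame w a m j) K)
  evalRec⇒↠ (suc n) u w a zero    j K eq = eval⇒↠ n u a _ eq
  evalRec⇒↠ (suc n) u w a (suc m) {r} j K eq with >>=-just {evalRec n (decode u) (decode w) a m} eq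
  ... | r′ , rec , next =
    subst (λ k → evalState u a (push (recFrame w a 0 k) K) ↠ returnState r′ (push (recFrame w a m (suc j)) K)) (+-suc m j)
          (evalRec⇒↠ n u w a m (suc j) K rec)
    ▸ ↠-step (step-rec-next r′ w a m j K)
    ▸ eval⇒↠ n w _ _ (subst (λ v → eval n (decode w) v ≡ just r) (sym pairs) next)
    where
    pairs : ⟨ ⟨ a , m ⟩ , r′ ⟩ ≡ ⟨ ⟨ a , m ⟩ᴰ , r′ ⟩ᴰ
    pairs = trans (⟨,⟩≡⟨,⟩ᴰ _ _) (cong (λ k → ⟨ k , r′ ⟩ᴰ) (⟨,⟩≡⟨,⟩ᴰ a m))

  evalMu⇒↠ : ∀ n u x i {y} K → evalMu n (decode u) x i ≡ just y →
             evalState u ⟨ x , i ⟩ (push (muFrame u x i) K) ↠ returnState y K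
  evalMu⇒↠ (suc n) u x i K eq with >>=-just {eval n (decode u) ⟨ x , i ⟩ᴰ} eq
  ... | zero  , ux , refl = eval⇒↠ n u _ _ (subst (λ v → eval n (decode u) v ≡ just 0) (sym (⟨,⟩≡⟨,⟩ᴰ x i)) ux)
                            ▸ ↠-step (step-mu-found u x i K)
  ... | suc v , ux , rest = eval⇒↠ n u _ _ (subst (λ k → eval n (decode u) k ≡ just (suc v)) (sym (⟨,⟩≡⟨,⟩ᴰ x i)) ux)
                            ▸ ↠-step (step-mu-next v u x i K) ▸ evalMu⇒↠ n u x (suc i) K rest

initialT runT haltedT outputT : Tm
initialT = evalStateT fstT sndT zT
runT     = recT initialT (stepT ∘T sndT)
haltedT  = ifzT (fstT ∘T runT) (constT 1) (ifzT (sndT ∘T sndT ∘T runT) zT (constT 1))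
outputT  = fstT ∘T sndT ∘T runT

-- On ⟨ c , x ⟩ : search the first halted state of the run from evalState c x emptyStack.
Universal : Code
Universal = Comp (compile outputT) (Pair Id (Mu (compile haltedT)))

haltFlag : ℕ → ℕ
haltFlag s = ifz (π₁ s) 1 (ifz (π₂ (π₂ s)) 0 1)

haltFlag-returnState : ∀ y → haltFlag (returnState y emptyStack) ≡ 0
haltFlag-returnState y rewrite unpair-pair 1 ⟨ y , 0 ⟩ | unpair-pair y 0 = refl

haltFlag≡0⇒run-fixed : ∀ s → haltFlag s ≡ 0 → ∀ t → run t s ≡ s
haltFlag≡0⇒run-fixed s halted zero    = refl
haltFlag≡0⇒run-fixed s halted (suc t) = trans (cong step (haltFlag≡0⇒run-fixed s halted t)) (step-fixed halted)
  where
  step-fixed : haltFlag s ≡ 0 → step s ≡ s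
  step-fixed eq with π₁ s | π₂ (π₂ s)
  ... | suc _ | zero = refl

runT-correct : ∀ c x n → ⟦ runT ⟧ ⟨ ⟨ c , x ⟩ , n ⟩ ≡ run n (evalState c x emptyStack)
runT-correct c x n rewrite unpair-pair ⟨ c , x ⟩ n = go n
  where
  go : ∀ n → ⟦rec⟧ initialT (stepT ∘T sndT) ⟨ c , x ⟩ n ≡ run n (evalState c x emptyStack)
  go zero    rewrite unpair-pair c x = refl
  go (suc n) rewrite π₂-pair ⟨ ⟨ c , x ⟩ , n ⟩ (⟦rec⟧ initialT (stepT ∘T sndT) ⟨ c , x ⟩ n) = cong step (go n)

Universal-correct : ∀ {c x y} → c · x ↓ y → Eval Universal ⟨ c , x ⟩ y
Universal-correct {c} {x} {y} (n , eq) =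
  let (T , reached) = eval⇒↠ n c x emptyStack eq
      (i , search , halted) = firstHalt T 0 (+-identityʳ T) reached
  in Eval-Comp (Eval-Pair (Eval-Id _) (Eval-Mu search))
               (compile-correct′ outputT _ (begin
                  ⟦ outputT ⟧ ⟨ ⟨ c , x ⟩ , i ⟩          ≡⟨ cong (π₁ ∘ π₂) (runT-correct c x i) ⟩
                  π₁ (π₂ (run i s₀))                     ≡⟨ cong (π₁ ∘ π₂) halted ⟩
                  π₁ (π₂ (returnState y emptyStack))     ≡⟨ cong π₁ (π₂-pair 1 ⟨ y , 0 ⟩) ⟩
                  π₁ ⟨ y , 0 ⟩                           ≡⟨ π₁-pair y 0 ⟩
                  y                                      ∎))
  where
  open ≡-Reasoning
  s₀ = evalState c x emptyStack
  flag : ∀ i → Eval (compile haltedT) ⟨ ⟨ c , x ⟩ , i ⟩ (haltFlag (run i s₀))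
  flag i = compile-correct′ haltedT _ (cong haltFlag (runT-correct c x i))
  -- scanning i = 0, 1, … : the state is halted at the latest when i reaches T
  firstHalt : ∀ {T} k i → k + i ≡ T → run T s₀ ≡ returnState y emptyStack →
              Σ ℕ λ i′ → EvalMu (compile haltedT) ⟨ c , x ⟩ i i′ × run i′ s₀ ≡ returnState y emptyStack
  firstHalt {T} k i k+i≡T reached with haltFlag (run i s₀) in halted
  ... | zero = i , EvalMu-zero (subst (Eval _ _) halted (flag i)) , (begin
    run i s₀             ≡⟨ haltFlag≡0⇒run-fixed (run i s₀) halted k ⟨
    run k (run i s₀)     ≡⟨ run-+ k i s₀ ⟨
    run (k + i) s₀       ≡⟨ cong (λ t → run t s₀) k+i≡T ⟩
    run T s₀             ≡⟨ reached ⟩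
    returnState y emptyStack ∎)
  firstHalt zero    i refl reached | suc v with () ← trans (sym halted) (trans (cong haltFlag reached) (haltFlag-returnState y))
  firstHalt (suc k) i k+i≡T reached | suc v =
    let (i′ , search , done) = firstHalt k (suc i) (trans (+-suc k i) k+i≡T) reached
    in i′ , EvalMu-suc (subst (Eval _ _) halted (flag i)) search , done

-- s-m-n and the chain of links

const# : ℕ → ℕ
const# zero    = 0
const# (suc v) = comp# 1 (const# v)

Eval-const# : ∀ v x → Eval (decode (const# v)) x v
Eval-const# zero    x = Eval-Z x
Eval-const# (suc v) x =
  subst (λ c → Eval c x (suc v)) (sym (decode-comp# 1 (const# v))) (Eval-Comp (Eval-const# v x) (Eval-S v))

smn# : ℕ → ℕ → ℕ
smn# e d = comp# e (pair# (const# d) (encode Id))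

smn#-correct : ∀ {e d b y} → Eval (decode e) ⟨ d , b ⟩ y → Eval (decode (smn# e d)) b y
smn#-correct {e} {d} {b} {y} e↓ =
  subst (λ c → Eval c b y) (sym decode-smn#) (Eval-Comp (Eval-Pair (Eval-const# d b) (Eval-Id b)) e↓)
  where
  decode-smn# : decode (smn# e d) ≡ Comp (decode e) (Pair (decode (const# d)) Id)
  decode-smn# = trans (decode-comp# e _) (cong (Comp (decode e)) (decode-pair# (const# d) (encode Id)))

comp#T pair#T : Tm → Tm → Tm
comp#T u w = plusT (constT 5) (mul9T ⟪ u , w ⟫)
pair#T u w = plusT (constT 6) (mul9T ⟪ u , w ⟫)

const#T : Tm
const#T = recT zT (comp#T (constT 1) sndT) ∘T ⟪ zT , idT ⟫

⟦const#T⟧ : ∀ v → ⟦ const#T ⟧ v ≡ const# v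
⟦const#T⟧ v rewrite unpair-pair 0 v = go v
  where
  go : ∀ m → ⟦rec⟧ zT (comp#T (constT 1) sndT) 0 m ≡ const# m
  go zero    = refl
  go (suc m) rewrite π₂-pair ⟨ 0 , m ⟩ (⟦rec⟧ zT (comp#T (constT 1) sndT) 0 m) = cong (comp# 1) (go m)

smn#T : Tm → Tm → Tm
smn#T e d = comp#T e (pair#T (const#T ∘T d) (constT (encode Id)))

⟦smn#T⟧ : ∀ e d x → ⟦ smn#T e d ⟧ x ≡ smn# (⟦ e ⟧ x) (⟦ d ⟧ x)
⟦smn#T⟧ e d x = cong (λ k → comp# (⟦ e ⟧ x) (pair# k (encode Id))) (⟦const#T⟧ (⟦ d ⟧ x))

When : Code → Code
When X = Rec Z (Comp X (Comp Fst Fst))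

Eval-When-0 : ∀ X d → Eval (When X) ⟨ d , 0 ⟩ 0
Eval-When-0 X d = Eval-Rec (EvalRec-zero (Eval-Z d))

Eval-When-1 : ∀ {X d y} → Eval X d y → Eval (When X) ⟨ d , 1 ⟩ y
Eval-When-1 {d = d} X↓ =
  Eval-Rec (EvalRec-suc (EvalRec-zero (Eval-Z d)) (Eval-Comp (Eval-Comp (Eval-Fst _ 0) (Eval-Fst d 0)) X↓))

-- Lazy, unlike IFZ: only the selected one of X and Y is run.
Branch : Code → Code → Code
Branch X Y = Comp ADD (Pair (Comp (When X) (compile ⟪ fstT , ifzT sndT (constT 1) zT ⟫))
                            (Comp (When Y) (Pair Fst Snd)))

Eval-Branch-0 : ∀ {X Y d y} → Eval X d y → Eval (Branch X Y) ⟨ d , 0 ⟩ y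
Eval-Branch-0 {X} {Y} {d} {y} X↓ = subst (Eval _ _) (+-identityʳ y)
  (Eval-Comp (Eval-Pair (Eval-Comp (compile-correct′ ⟪ fstT , ifzT sndT (constT 1) zT ⟫ _ flag) (Eval-When-1 X↓))
                        (Eval-Comp (Eval-Pair (Eval-Fst d 0) (Eval-Snd d 0)) (Eval-When-0 Y d)))
             (Eval-ADD y 0))
  where
  flag : ⟨ π₁ ⟨ d , 0 ⟩ , ifz (π₂ ⟨ d , 0 ⟩) 1 0 ⟩ ≡ ⟨ d , 1 ⟩
  flag rewrite unpair-pair d 0 = refl

Eval-Branch-1 : ∀ {X Y d y} → Eval Y d y → Eval (Branch X Y) ⟨ d , 1 ⟩ y
Eval-Branch-1 {X} {Y} {d} {y} Y↓ =
  Eval-Comp (Eval-Pair (Eval-Comp (compile-correct′ ⟪ fstT , ifzT sndT (constT 1) zT ⟫ _ flag) (Eval-When-0 X d))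
                       (Eval-Comp (Eval-Pair (Eval-Fst d 1) (Eval-Snd d 1)) (Eval-When-1 Y↓)))
            (Eval-ADD 0 y)
  where
  flag : ⟨ π₁ ⟨ d , 1 ⟩ , ifz (π₂ ⟨ d , 1 ⟩) 1 0 ⟩ ≡ ⟨ d , 0 ⟩
  flag rewrite unpair-pair d 1 = refl

chainData : ℕ → ℕ → ℕ → ℕ → ℕ → ℕ
chainData E a c f t = ⟨ E , ⟨ a , ⟨ c , ⟨ f , t ⟩ ⟩ ⟩ ⟩

selfT aT cT fT tT : Tm
selfT = fstT
aT    = fstT ∘T sndT
cT    = fstT ∘T sndT ∘T sndT
fT    = fstT ∘T sndT ∘T sndT ∘T sndT
tT    = sndT ∘T sndT ∘T sndT ∘T sndT

nextDataT nextLinkT : Tm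
nextDataT = ⟪ selfT , ⟪ aT , ⟪ cT , ⟪ fT , sT ∘T tT ⟫ ⟫ ⟫ ⟫
nextLinkT = ⟪ cT , smn#T selfT nextDataT ⟫

-- On ⟨ chainData E a c f t , b ⟩, where E is the number of this very code:
-- for b = 0 it computes a · (f · t), for b = 1 it computes c · (the next link, for t + 1).
Chain : Code
Chain = Branch (Comp Universal (Pair (compile aT) (Comp Universal (compile ⟪ fT , tT ⟫))))
               (Comp Universal (compile nextLinkT))

-- Opaque, so that the enormous numeral is never normalised.
opaque
  chain# : ℕ
  chain# = encode Chain

  decode-chain# : decode chain# ≡ Chain
  decode-chain# = decode-encode Chain

-- Passing the chain its own number as data replaces the recursion theorem.
chainLink : ℕ → ℕ → ℕ → ℕ → ℕ
chainLink a c f s = smn# chain# (chainData chain# a c f s)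

chainLink-0 : ∀ {a c f s u y} → f · s ↓ u → a · u ↓ y → chainLink a c f s · 0 ↓ y
chainLink-0 {a} {c} {f} {s} {y = y} f↓ a↓ = smn#-correct (subst (λ k → Eval k ⟨ d , 0 ⟩ y) (sym decode-chain#)
  (Eval-Branch-0 (Eval-Comp (Eval-Pair (compile-correct′ aT _ fieldA)
                                       (Eval-Comp (compile-correct′ ⟪ fT , tT ⟫ _ fieldsFT) (Universal-correct f↓)))
                            (Universal-correct a↓))))
  where
  d = chainData chain# a c f s
  fieldA : ⟦ aT ⟧ d ≡ a
  fieldA rewrite unpair-pair chain# ⟨ a , ⟨ c , ⟨ f , s ⟩ ⟩ ⟩ | unpair-pair a ⟨ c , ⟨ f , s ⟩ ⟩ = refl
  fieldsFT : ⟦ ⟪ fT , tT ⟫ ⟧ d ≡ ⟨ f , s ⟩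
  fieldsFT rewrite unpair-pair chain# ⟨ a , ⟨ c , ⟨ f , s ⟩ ⟩ ⟩ | unpair-pair a ⟨ c , ⟨ f , s ⟩ ⟩
                 | unpair-pair c ⟨ f , s ⟩ | unpair-pair f s = refl

chainLink-1 : ∀ {a c f s y} → c · chainLink a c f (suc s) ↓ y → chainLink a c f s · 1 ↓ y
chainLink-1 {a} {c} {f} {s} {y} c↓ = smn#-correct (subst (λ k → Eval k ⟨ d , 1 ⟩ y) (sym decode-chain#)
  (Eval-Branch-1 (Eval-Comp (compile-correct′ nextLinkT _ fieldsNext)
                            (Universal-correct c↓))))
  where
  d = chainData chain# a c f s
  fieldsNext : ⟦ nextLinkT ⟧ d ≡ ⟨ c , chainLink a c f (suc s) ⟩
  fieldsNext rewrite ⟦smn#T⟧ selfT nextDataT d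
                   | unpair-pair chain# ⟨ a , ⟨ c , ⟨ f , s ⟩ ⟩ ⟩ | unpair-pair a ⟨ c , ⟨ f , s ⟩ ⟩
                   | unpair-pair c ⟨ f , s ⟩ | unpair-pair f s = refl

startDataT startT : Tm
startDataT = ⟪ constT chain# , ⟪ fstT ∘T sndT , ⟪ sndT ∘T sndT , ⟪ fstT , zT ⟫ ⟫ ⟫ ⟫
startT     = ⟪ sndT ∘T sndT , smn#T (constT chain#) startDataT ⟫

Start : Code
Start = Comp Universal (compile startT)

opaque
  start# : ℕ
  start# = encode Start

  decode-start# : decode start# ≡ Start
  decode-start# = decode-encode Start

  reducer# : ℕ
  reducer# = encode (compile (smn#T (constT start#) idT))

  decode-reducer# : decode reducer# ≡ compile (smn#T (constT start#) idT)
  decode-reducer# = decode-encode _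

reducer#-correct : ∀ f → reducer# · f ↓ smn# start# f
reducer#-correct f = subst (λ k → Eval k f (smn# start# f)) (sym decode-reducer#)
  (compile-correct′ (smn#T (constT start#) idT) f (⟦smn#T⟧ (constT start#) idT f))

start#-correct : ∀ {a c f y} → c · chainLink a c f 0 ↓ y → smn# start# f · ⟨ a , c ⟩ᴰ ↓ y
start#-correct {a} {c} {f} {y} c↓ = subst (λ x → smn# start# f · x ↓ y) (⟨,⟩≡⟨,⟩ᴰ a c)
  (smn#-correct (subst (λ k → Eval k ⟨ f , ⟨ a , c ⟩ ⟩ y) (sym decode-start#)
    (Eval-Comp (compile-correct′ startT _ fields) (Universal-correct c↓))))
  where
  fields : ⟦ startT ⟧ ⟨ f , ⟨ a , c ⟩ ⟩ ≡ ⟨ c , chainLink a c f 0 ⟩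
  fields rewrite ⟦smn#T⟧ (constT chain#) startDataT ⟨ f , ⟨ a , c ⟩ ⟩
               | unpair-pair f ⟨ a , c ⟩ | unpair-pair a c = refl

-- Realizability

chainLink-G¬¬ : ∀ {p q : Pred lzero} {a c f t u} → (p ⇒ q) a → (G Fam01 q ⇒ q) c → f · t ↓ u → p u →
                ∀ k {s} → k + s ≡ t → G Fam01 q (chainLink a c f s)
chainLink-G¬¬ a∈ c∈ f↓ pu zero refl = t0 , λ { _ refl →
  let (y , a↓ , qy) = a∈ _ pu in y , chainLink-0 f↓ a↓ , qy }
chainLink-G¬¬ a∈ c∈ f↓ pu (suc k) {s} k+s≡t = t1 , λ { _ refl →
  let (y , c↓ , qy) = c∈ _ (chainLink-G¬¬ a∈ c∈ f↓ pu k (trans (+-suc k s) k+s≡t)) in y , chainLink-1 c↓ , qy }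

G≤L¬¬ : (𝒜 : Family) → (∀ i → Σ ℕ (set 𝒜 i)) → G 𝒜 ≤L G Fam01
G≤L¬¬ 𝒜 inhabited = reducer# , λ p f (i , f∈A⇒p) → smn# start# f , reducer#-correct f ,
  λ { q _ (a , c , a∈p⇒q , c∈G¬¬q⇒q , refl) →
    let (t , t∈A) = inhabited i
        (u , f↓ , pu) = f∈A⇒p t t∈A
        (y , c↓ , qy) = c∈G¬¬q⇒q _ (chainLink-G¬¬ a∈p⇒q c∈G¬¬q⇒q f↓ pu t (+-identityʳ t))
    in y , start#-correct c↓ , qy }

base# next# : ℕ
base# = encode (Pair Z Id)
next# = encode (Pair (Comp S Z) Id)

Intersecting : Family → Set
Intersecting 𝒜 = ∀ i j → Σ ℕ λ a → set 𝒜 i a × set 𝒜 j a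

module _ (𝒜 : Family) where

  data Tower (b : ℕ) : ℕ → Set where
    base : ∀ {n} → n ≡ ⟨ 0 , b ⟩ → Tower b n
    next : ∀ {n} z → n ≡ ⟨ 1 , z ⟩ → G 𝒜 (Tower b) z → Tower b n

  -- Two members of 𝒜 share an element a, and z · a has only one value.
  Tower-disjoint : Intersecting 𝒜 → ∀ {b b′ n} → b ≢ b′ → Tower b n → Tower b′ n → ⊥
  Tower-disjoint meet b≢b′ (base eq)    (base eq′)     = b≢b′ (proj₂ (pair-injective (trans (sym eq) eq′)))
  Tower-disjoint meet b≢b′ (base eq)    (next _ eq′ _) with () ← proj₁ (pair-injective (trans (sym eq) eq′))
  Tower-disjoint meet b≢b′ (next _ eq _) (base eq′)    with () ← proj₁ (pair-injective (trans (sym eq) eq′))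
  Tower-disjoint meet b≢b′ (next z eq (i , z∈A⇒T)) (next z′ eq′ (i′ , z′∈A′⇒T′))
    with refl ← proj₂ (pair-injective (trans (sym eq) eq′)) =
    let (a , a∈A , a∈A′) = meet i i′
        (y , z↓ , Ty) = z∈A⇒T a a∈A
        (y′ , z↓′ , Ty′) = z′∈A′⇒T′ a a∈A′
    in Tower-disjoint meet b≢b′ Ty (subst (Tower _) (Eval-functional z↓′ z↓) Ty′)

  towerTop : ∀ b r → L (G 𝒜) (_≡ b) r → Σ ℕ λ y → r · ⟨ base# , next# ⟩ᴰ ↓ y × Tower b y
  towerTop b r r∈L = r∈L (Tower b) _ (base# , next# , base#∈ , next#∈ , refl)
    where
    base#∈ : ((_≡ b) ⇒ Tower b) base#
    base#∈ _ refl = ⟨ 0 , b ⟩ , encode-↓ (Eval-Pair (Eval-Z b) (Eval-Id b)) , base refl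
    next#∈ : (G 𝒜 (Tower b) ⇒ Tower b) next#
    next#∈ z z∈G = ⟨ 1 , z ⟩ , encode-↓ (Eval-Pair (Eval-Comp (Eval-Z z) (Eval-S 0)) (Eval-Id z)) , next z refl z∈G

¬¬≰LG : (𝒜 : Family) → Intersecting 𝒜 → ¬ (G Fam01 ≤L G 𝒜)
¬¬≰LG 𝒜 meet (e , reduce) =
  let (r₀ , e↓₀ , r₀∈L) = reduce (_≡ 0) (encode Id) (t0 , λ a a≡0 → a , Eval-Id a , a≡0)
      (r₁ , e↓₁ , r₁∈L) = reduce (_≡ 1) (encode Id) (t1 , λ a a≡1 → a , Eval-Id a , a≡1)
      (y₀ , r↓₀ , T₀) = towerTop 𝒜 0 r₀ r₀∈L
      (y₁ , r↓₁ , T₁) = towerTop 𝒜 1 r₁ r₁∈L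
      r₁↓₀ = subst (λ r → r · _ ↓ y₁) (Eval-functional e↓₁ e↓₀) r↓₁
  in Tower-disjoint 𝒜 meet (λ ()) T₀ (subst (Tower 𝒜 1) (Eval-functional r₁↓₀ r↓₀) T₁)

-- 𝒥 is intersecting

meet⊎∣∁∣+∣∁∣≥n : ∀ {n} (X Y : Subset n) → (Σ (Fin n) λ i → i ∈ X × i ∈ Y) ⊎ n ≤ ∣ ∁ X ∣ + ∣ ∁ Y ∣
meet⊎∣∁∣+∣∁∣≥n []          []          = inj₂ z≤n
meet⊎∣∁∣+∣∁∣≥n (true ∷ X)  (true ∷ Y)  = inj₁ (Fin.zero , here , here)
meet⊎∣∁∣+∣∁∣≥n (false ∷ X) (y ∷ Y)     with meet⊎∣∁∣+∣∁∣≥n X Y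
... | inj₁ (i , i∈X , i∈Y) = inj₁ (Fin.suc i , there i∈X , there i∈Y)
... | inj₂ n≤ = inj₂ (s≤s (≤-trans n≤ (+-monoʳ-≤ ∣ ∁ X ∣ (∣p∣≤∣x∷p∣ (not y) (∁ Y)))))
meet⊎∣∁∣+∣∁∣≥n (true ∷ X)  (false ∷ Y) with meet⊎∣∁∣+∣∁∣≥n X Y
... | inj₁ (i , i∈X , i∈Y) = inj₁ (Fin.suc i , there i∈X , there i∈Y)
... | inj₂ n≤ = inj₂ (≤-trans (s≤s n≤) (≤-reflexive (sym (+-suc ∣ ∁ X ∣ ∣ ∁ Y ∣))))

O-intersecting : ∀ m → Intersecting (O (2 * m + 1) m)
O-intersecting m (oix X ∣∁X∣≡m) (oix Y ∣∁Y∣≡m) with meet⊎∣∁∣+∣∁∣≥n X Y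
... | inj₁ (i , i∈X , i∈Y) = suc (toℕ i) , (i , refl , i∈X) , (i , refl , i∈Y)
... | inj₂ n≤ = ⊥-elim (no-room (subst (2 * m + 1 ≤_) (cong₂ _+_ ∣∁X∣≡m ∣∁Y∣≡m) n≤))
  where
  no-room : ¬ (2 * m + 1 ≤ m + m)
  no-room = n≮n (m + m) ∘ subst (_≤ m + m) (trans (+-comm (2 * m) 1) (cong (λ k → suc (m + k)) (+-identityʳ m)))

⊙-intersecting : ∀ {𝒜 ℬ} → Intersecting 𝒜 → Intersecting ℬ → Intersecting (𝒜 ⊙ ℬ)
⊙-intersecting 𝒜-meet ℬ-meet (i , j) (i′ , j′) =
  let (a , a∈ , a∈′) = 𝒜-meet i i′
      (b , b∈ , b∈′) = ℬ-meet j j′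
  in ⟨ a , b ⟩ᴰ , (a , b , a∈ , b∈ , refl) , (a , b , a∈′ , b∈′ , refl)

𝒥-intersecting : ∀ k → Intersecting (𝒥 k)
𝒥-intersecting zero          = O-intersecting 0
𝒥-intersecting (suc zero)    = O-intersecting 1
𝒥-intersecting (suc (suc k)) = ⊙-intersecting (𝒥-intersecting (suc k)) (O-intersecting (suc (suc k)))

-- 𝒥 0 = O^1_0 is intersecting too.
proposition5p15 : (k : ℕ) → 1 ≤ k →
    (G (𝒥 k) ≤L G Fam01) × ¬ (G Fam01 ≤L G (𝒥 k))
proposition5p15 k _ = G≤L¬¬ (𝒥 k) inhabited , ¬¬≰LG (𝒥 k) (𝒥-intersecting k)
  where
  inhabited : ∀ i → Σ ℕ (set (𝒥 k) i)
  inhabited i = let (a , a∈ , _) = 𝒥-intersecting k i i in a , a∈
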